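{- Let $\mathcal{P}$ and $\mathcal{Q}$ be finite chiral or directly regular $n$-polytopes. Let $g_1=\gcd(|X(\mathcal{P})|,|\Gamma^+(\mathcal{Q})|)$ and $g_2=\gcd(|X(\mathcal{Q})|,|\Gamma^+(\mathcal{P})|)$. Then $|X(\mathcal{P}\diamond\mathcal{Q})|$ is divisible by $|X(\mathcal{P})|/g_1$ and by $|X(\mathcal{Q})|/g_2$.
   Context: All polytopes are abstract polytopes. A regular polytope is directly regular if its rotation group $\Gamma^+(\mathcal{P})$, generated by $\sigma_i=\rho_{i-1}\rho_i$ ($\rho_0,\dots,\rho_{n-1}$ the standard generating involutions relative to a base flag), has index $2$ in the automorphism group. A polytope is chiral if its automorphism group has two orbits on flags, adjacent flags lying in distinct orbits; then $\Gamma^+(\mathcal{P})$ is the full automorphism group, generated by standard rotations $\sigma_1,\dots,\sigma_{n-1}$. Let $W^+=\langle \sigma_1,\dots,\sigma_{n-1}\mid (\sigma_i\cdots\sigma_j)^2=1,\ 1\le i<j\le n-1\rangle$; each such $\Gamma^+(\mathcal{P})$ equals $W^+/M$ for a normal subgroup $M$, generators corresponding. Let $w\mapsto\overline{w}$ be the automorphism of $W^+$ with $\sigma_1\mapsto\sigma_1^{ -1}$, $\sigma_2\mapsto\sigma_1^2\sigma_2$, $\sigma_j\mapsto\sigma_j$ ($j\ge3$). Mix: if $\Gamma^+(\mathcal{P})=W^+/M$ and $\Gamma^+(\mathcal{Q})=W^+/K$, the mix $\mathcal{P}\diamond\mathcal{Q}$ is the (flag-connected pre-)polytope whose rotation group is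 the subgroup of $\Gamma^+(\mathcal{P})\times\Gamma^+(\mathcal{Q})$ generated by $(\sigma_i,\sigma_i')$, isomorphic to $W^+/(M\cap K)$. Chirality group: for any (pre-)polytope with rotation group $W^+/N$, $X=N\overline{N}/N$, the kernel of the natural epimorphism $W^+/N\to W^+/(N\overline N)$ (isomorphic to $N/(N\cap\overline N)$). -}

module Defs where

open import Level using (Level; _⊔_) renaming (suc to lsuc)
open import Algebra.Bundles using (Group)
open import Data.Nat using (ℕ; zero; suc; _+_; _∸_; _<_; _<?_)
open import Data.Fin using (Fin; zero; suc; toℕ; fromℕ<)
open import Data.Fin.Subset using (Subset; _∈_; _∩_)
open import Data.Bool using (Bool; true; false; not)
open import Data.List using (List; []; _∷_; _++_; reverse; map; foldr; upTo)
open import Data.Product using (_×_; _,_; ∃-syntax)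
open import Data.Unit.Polymorphic using (⊤)
open import Relation.Binary.PropositionalEquality using (_≡_)
open import Relation.Nullary using (yes; no)

-- Words in the free group on σ₁,…,σ_r (r = n-1).  Generator σ_{k+1} is
-- represented by index k : Fin r; the Bool flag 'true' means the inverse.
-- W⁺ is a quotient of this free group, so every element of W⁺ (and of
-- any W⁺/M) is represented by such a word.

Letter : ℕ → Set
Letter r = Fin r × Bool

Word : ℕ → Set
Word r = List (Letter r)

invW : ∀ {r} → Word r → Word r
invW w = reverse (map (λ { (i , b) → (i , not b) }) w)

-- image of a generator under the automorphism  w ↦ w̄  of W⁺:
-- σ₁ ↦ σ₁⁻¹ ,  σ₂ ↦ σ₁ σ₁ σ₂ ,  σⱼ ↦ σⱼ (j ≥ 3)
barGen : ∀ {r} → Fin r → Word r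
barGen zero = (zero , true) ∷ []
barGen (suc zero) = (zero , false) ∷ (zero , false) ∷ (suc zero , false) ∷ []
barGen (suc (suc i)) = (suc (suc i) , false) ∷ []

bar : ∀ {r} → Word r → Word r
bar [] = []
bar ((i , false) ∷ w) = barGen i ++ bar w
bar ((i , true) ∷ w) = invW (barGen i) ++ bar w

module _ {c ℓ} (G : Group c ℓ) where
  open Group G

  eval : ∀ {r} → (Fin r → Carrier) → Word r → Carrier
  eval σ [] = ε
  eval σ ((i , false) ∷ w) = σ i ∙ eval σ w
  eval σ ((i , true) ∷ w) = (σ i ⁻¹) ∙ eval σ w

  -- σ_{k+1} for k < r, identity otherwise
  gen : ∀ {r} → (Fin r → Carrier) → ℕ → Carrier
  gen {r} σ k with k <? r
  ... | yes p = σ (fromℕ< p)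
  ... | no _ = ε

  -- τ a b = σ_{a+1} σ_{a+2} ⋯ σ_b   (Schulte–Weiss τ_{a,b} for a < b)
  τ : ∀ {r} → (Fin r → Carrier) → ℕ → ℕ → Carrier
  τ σ a b = foldr (λ k acc → gen σ k ∙ acc) ε (map (a +_) (upTo (b ∸ a)))

  data InSub {n} (σ : Fin (n ∸ 1) → Carrier) (I : Subset n) : Carrier → Set (c ⊔ ℓ) where
    τ-in : ∀ (i j : Fin n) → i ∈ I → j ∈ I → toℕ i < toℕ j →
           InSub σ I (τ σ (toℕ i) (toℕ j))
    ε-in : InSub σ I ε
    ∙-in : ∀ {x y} → InSub σ I x → InSub σ I y → InSub σ I (x ∙ y)
    ⁻¹-in : ∀ {x} → InSub σ I x → InSub σ I (x ⁻¹)
    ≈-in : ∀ {x y} → x ≈ y → InSub σ I x → InSub σ I y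

-- Cardinality of a subset of a setoid-carrier: 'Size _≈_ P k' says the
-- elements satisfying P form exactly k classes.

record Size {a ℓ p} {A : Set a} (_≈_ : A → A → Set ℓ) (P : A → Set p) (k : ℕ)
            : Set (a ⊔ ℓ ⊔ p) where
  field
    elem : Fin k → A
    elem-in : ∀ i → P (elem i)
    elem-inj : ∀ i j → elem i ≈ elem j → i ≡ j
    elem-surj : ∀ x → P x → ∃[ i ] (x ≈ elem i)

-- Rotation group Γ⁺(𝒫) = W⁺/M of a chiral or directly regular n-polytope,
-- given by the Schulte–Weiss characterisation: a group generated by
-- σ₁,…,σ_{n-1} satisfying (σᵢ⋯σⱼ)² = 1 (i<j) and the intersection condition.

record RotGroup (n : ℕ) (c ℓ : Level) : Set (lsuc (c ⊔ ℓ)) where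
  field
    group : Group c ℓ
  open Group group public
  field
    σ : Fin (n ∸ 1) → Carrier
    relations : ∀ a b → a < b → b < n ∸ 1 →
                (τ group σ a (suc b) ∙ τ group σ a (suc b)) ≈ ε
    generated : ∀ g → ∃[ w ] (eval group σ w ≈ g)
    intersection : ∀ (I J : Subset n) (g : Carrier) →
      ((InSub group σ I g × InSub group σ J g) → InSub group σ (I ∩ J) g)
      × (InSub group σ (I ∩ J) g → (InSub group σ I g × InSub group σ J g))

module _ {n c ℓ} (P : RotGroup n c ℓ) where
  open RotGroup P

  OrderΓ : ℕ → Set _
  OrderΓ k = Size _≈_ (λ (_ : Carrier) → ⊤ {ℓ = c}) k

  -- chirality group X(𝒫) = N N̄ / N ⊆ W⁺/N, with N the kernel of W⁺ → Γ⁺(𝒫):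
  -- it is the image in Γ⁺(𝒫) of N̄ = { w̄ | w ∈ N }.
  XMem : Carrier → Set ℓ
  XMem g = ∃[ w ] (eval group σ w ≈ ε × eval group σ (bar w) ≈ g)

  OrderX : ℕ → Set _
  OrderX k = Size _≈_ XMem k

-- The mix 𝒫 ◇ 𝒬: its rotation group is the subgroup of Γ⁺(𝒫) × Γ⁺(𝒬)
-- generated by (σᵢ, σᵢ'), i.e. W⁺/(M ∩ K).  Its chirality group is the image
-- of (M ∩ K)‾ in it.
module _ {n c₁ ℓ₁ c₂ ℓ₂} (P : RotGroup n c₁ ℓ₁) (Q : RotGroup n c₂ ℓ₂) where
  private
    module P = RotGroup P
    module Q = RotGroup Q

  _≈mix_ : P.Carrier × Q.Carrier → P.Carrier × Q.Carrier → Set (ℓ₁ ⊔ ℓ₂)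
  (g , h) ≈mix (g' , h') = (g P.≈ g') × (h Q.≈ h')

  XMixMem : P.Carrier × Q.Carrier → Set (ℓ₁ ⊔ ℓ₂)
  XMixMem (g , h) = ∃[ w ] ((eval P.group P.σ w P.≈ P.ε × eval Q.group Q.σ w Q.≈ Q.ε)
                          × (eval P.group P.σ (bar w) P.≈ g × eval Q.group Q.σ (bar w) Q.≈ h))

  OrderXMix : ℕ → Set _
  OrderXMix k = Size _≈mix_ XMixMem k

-- Write Γ⁺(𝒫) = W⁺/M and Γ⁺(𝒬) = W⁺/K. In Γ⁺(𝒫) × Γ⁺(𝒬) consider the subgroup
-- S = { (w̄ M, w K) | w ∈ M }. Its first projection is X(𝒫), with kernel ≅ L = { h | (1, h) ∈ S }.
-- Its second projection T contains L, and its kernel consists of the (w̄ M, 1) with w ∈ M ∩ K,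
-- so it is ≅ the first projection Y of X(𝒫 ◇ 𝒬) ≤ Γ⁺(𝒫) × Γ⁺(𝒬). Counting S both ways gives
-- |X(𝒫)| · |L| = |T| · |Y|, i.e. |X(𝒫)| = [T : L] · |Y|, and by Lagrange [T : L] divides both
-- |X(𝒫)| and |Γ⁺(𝒬)|, hence g₁. So |X(𝒫)|/g₁ divides |Y|, which divides |X(𝒫 ◇ 𝒬)|.
-- Exchanging 𝒫 and 𝒬 gives the other divisibility.

module Submission where

open import Algebra.Bundles using (Group)
import Algebra.Construct.DirectProduct as DirectProduct
import Algebra.Morphism.Construct.DirectProduct as DirectProductMorphisms
open import Algebra.Morphism.Structures using (module GroupMorphisms)
import Algebra.Properties.Group as GroupProperties
open import Data.Bool using (true; false; not)
open import Data.Fin using (Fin; zero; suc; toℕ; combine; remQuot)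
open import Data.Fin.Properties
  using (suc-injective; toℕ-injective; cantor-schröder-bernstein; *↔×; combine-remQuot; remQuot-combine;
         all?; any?)
  renaming (_≟_ to _≟ᶠ_)
open import Data.List using ([]; _∷_; _++_; [_]; map)
open import Data.List.Properties using (++-assoc; ++-identityʳ; unfold-reverse)
open import Data.Nat using (ℕ; zero; suc; _*_; _≤_; _≤?_; z≤n; s≤s; NonZero)
open import Data.Nat.Divisibility using (_∣_; _∣?_; divides; ∣-trans; *-monoʳ-∣; *-cancelˡ-∣)
open import Data.Nat.GCD using (gcd; gcd-greatest)
open import Data.Nat.Properties
  using (≤-antisym; *-comm; *-cancelʳ-≡; m*n≢0⇒m≢0; m*n≢0⇒n≢0; *-commutativeSemigroup)
open import Algebra.Properties.CommutativeSemigroup *-commutativeSemigroup using (xy∙z≈xz∙y)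
open import Data.Product using (_×_; _,_; proj₁; proj₂; ∃; ∃-syntax; swap)
open import Data.Product.Relation.Binary.Pointwise.NonDependent using (Pointwise)
open import Data.Unit.Polymorphic using (⊤; tt)
open import Function using (_∘_; Injective)
open import Function.Bundles using (Injection)
open import Function.Properties.Inverse using (Inverse⇒Injection; ↔-sym)
open import Level using (Level; _⊔_)
open import Relation.Binary using (Rel; IsEquivalence)
open import Relation.Binary.Definitions using (_Respects_) renaming (Decidable to Decidable₂)
open import Relation.Binary.PropositionalEquality using (_≡_; cong)
import Relation.Binary.PropositionalEquality as ≡
open import Relation.Nullary using (yes; no; ¬_; contradiction)
open import Relation.Nullary.Decidable using (¬¬-excluded-middle; map′; _→-dec_; decidable-stable)
open import Relation.Unary using (Pred; Decidable)

open import Defs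

private variable
  a b c c₁ c₂ ℓ ℓ′ ℓ₁ ℓ₂ p q r : Level

open Size

Fin-subset-size : ∀ k (D : Pred (Fin k) p) → Decidable D → ∃[ m ] Size _≡_ D m
Fin-subset-size zero D D? = 0 , record
  { elem = λ () ; elem-in = λ () ; elem-inj = λ () ; elem-surj = λ () }
Fin-subset-size (suc k) D D? with Fin-subset-size k (D ∘ suc) (D? ∘ suc) | D? zero
... | m , S | yes d₀ = suc m , record
  { elem = e ; elem-in = e-in ; elem-inj = e-inj ; elem-surj = e-surj }
  where
  e : Fin (suc m) → Fin (suc k)
  e zero = zero
  e (suc j) = suc (elem S j)
  e-in : ∀ j → D (e j)
  e-in zero = d₀
  e-in (suc j) = elem-in S j
  e-inj : ∀ i j → e i ≡ e j → i ≡ j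
  e-inj zero zero _ = ≡.refl
  e-inj (suc i) (suc j) eq = cong suc (elem-inj S i j (suc-injective eq))
  e-surj : ∀ i → D i → ∃[ j ] (i ≡ e j)
  e-surj zero _ = zero , ≡.refl
  e-surj (suc i) d with elem-surj S i d
  ... | j , ≡.refl = suc j , ≡.refl
... | m , S | no ¬d₀ = m , record
  { elem = suc ∘ elem S ; elem-in = elem-in S
  ; elem-inj = λ i j eq → elem-inj S i j (suc-injective eq) ; elem-surj = e-surj }
  where
  e-surj : ∀ i → D i → ∃[ j ] (i ≡ suc (elem S j))
  e-surj zero d₀ = contradiction d₀ ¬d₀
  e-surj (suc i) d with elem-surj S i d
  ... | j , ≡.refl = j , ≡.refl

Fin-least : ∀ k (D : Pred (Fin k) p) → Decidable D → ∃ D →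
  ∃[ j ] (D j × ∀ {i} → D i → toℕ j ≤ toℕ i)
Fin-least (suc k) D D? (i , dᵢ) with D? zero
... | yes d₀ = zero , d₀ , λ _ → z≤n
... | no ¬d₀ with i | dᵢ
...   | zero  | d₀ = contradiction d₀ ¬d₀
...   | suc i | d with Fin-least k (D ∘ suc) (D? ∘ suc) (i , d)
...     | j , dⱼ , least = suc j , dⱼ , bound
  where
  bound : ∀ {i} → D i → toℕ (suc j) ≤ toℕ i
  bound {zero} d₀ = contradiction d₀ ¬d₀
  bound {suc i} d = s≤s (least d)

Fin-¬¬decidable : ∀ k (D : Pred (Fin k) p) → ¬ ¬ Decidable D
Fin-¬¬decidable zero D ¬D? = ¬D? (λ ())
Fin-¬¬decidable (suc k) D ¬D? = ¬¬-excluded-middle λ D₀? →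
  Fin-¬¬decidable k (D ∘ suc) λ D∘suc? → ¬D? λ { zero → D₀? ; (suc i) → D∘suc? i }

Fin-×-cantor-schröder-bernstein : ∀ {x y s} {f : Fin x → Fin y × Fin s} {g : Fin y × Fin s → Fin x} →
  Injective _≡_ _≡_ f → Injective _≡_ _≡_ g → x ≡ y * s
Fin-×-cantor-schröder-bernstein {y = y} {s} f-inj g-inj =
  cantor-schröder-bernstein (f-inj ∘ from-inj) (to-inj ∘ g-inj)
  where
  to-inj = Injection.injective (Inverse⇒Injection (*↔× {y} {s}))
  from-inj = Injection.injective (Inverse⇒Injection (↔-sym (*↔× {y} {s})))

Image : {A : Set a} {B : Set b} (_≈_ : Rel B ℓ) (f : A → B) (X : Pred A p) → Pred B (a ⊔ ℓ ⊔ p)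
Image _≈_ f X y = ∃[ x ] (X x × f x ≈ y)

size-cong : {A : Set a} {_≈_ : Rel A ℓ} {P : Pred A p} {Q : Pred A q} {k : ℕ} →
  Size _≈_ P k → (∀ {x} → P x → Q x) → (∀ {x} → Q x → P x) → Size _≈_ Q k
size-cong S P⇒Q Q⇒P = record
  { elem = elem S ; elem-in = P⇒Q ∘ elem-in S ; elem-inj = elem-inj S
  ; elem-surj = λ x → elem-surj S x ∘ Q⇒P }

size-nonZero : {A : Set a} {_≈_ : Rel A ℓ} {P : Pred A p} {k : ℕ} →
  Size _≈_ P k → ∀ {x} → P x → NonZero k
size-nonZero {k = zero} S {x} px with () ← proj₁ (elem-surj S x px)
size-nonZero {k = suc k} S px = _

module _ {A : Set a} {_≈_ : Rel A ℓ} (≈-equiv : IsEquivalence _≈_) where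
  private module ≈ = IsEquivalence ≈-equiv

  module _ {P : Pred A p} {k : ℕ} (S : Size _≈_ P k) where

    size-restrict : {D : Pred (Fin k) q} {m : ℕ} → Size _≡_ D m →
      Size _≈_ (λ x → ∃[ i ] (D i × x ≈ elem S i)) m
    size-restrict {D = D} D-size = record
      { elem = elem S ∘ elem D-size
      ; elem-in = λ j → elem D-size j , elem-in D-size j , ≈.refl
      ; elem-inj = λ i j eq → elem-inj D-size i j (elem-inj S _ _ eq)
      ; elem-surj = surj }
      where
      surj : ∀ x → ∃[ i ] (D i × x ≈ elem S i) → ∃[ j ] (x ≈ elem S (elem D-size j))
      surj x (i , dᵢ , x≈) with elem-surj D-size i dᵢ
      ... | j , ≡.refl = j , x≈

    index : ∀ {x} → P x → Fin k
    index {x} px = proj₁ (elem-surj S x px)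

    ≈-elem-index : ∀ {x} (px : P x) → x ≈ elem S (index px)
    ≈-elem-index {x} px = proj₂ (elem-surj S x px)

    index-injective : ∀ {x y} (px : P x) (py : P y) → index px ≡ index py → x ≈ y
    index-injective px py eq =
      ≈.trans (≈-elem-index px) (≈.trans (≈.reflexive (cong (elem S) eq)) (≈.sym (≈-elem-index py)))

    index-cong : ∀ {x y} (px : P x) (py : P y) → x ≈ y → index px ≡ index py
    index-cong px py x≈y =
      elem-inj S _ _ (≈.trans (≈.sym (≈-elem-index px)) (≈.trans x≈y (≈-elem-index py)))

    size⇒decidable : Decidable₂ _≈_ → P Respects _≈_ → Decidable P
    size⇒decidable _≈?_ P-resp x = map′ from to (any? (λ i → x ≈? elem S i))
      where
      from : ∃[ i ] (x ≈ elem S i) → P x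
      from (i , x≈) = P-resp (≈.sym x≈) (elem-in S i)
      to : P x → ∃[ i ] (x ≈ elem S i)
      to = elem-surj S x

    size-filter : {Q : Pred A q} → P Respects _≈_ → Q Respects _≈_ → Decidable Q →
      ∃[ m ] Size _≈_ (λ x → P x × Q x) m
    size-filter {Q = Q} P-resp Q-resp Q? with Fin-subset-size k (Q ∘ elem S) (Q? ∘ elem S)
    ... | m , D = m , size-cong (size-restrict D)
      (λ (i , qᵢ , x≈) → P-resp (≈.sym x≈) (elem-in S i) , Q-resp (≈.sym x≈) qᵢ)
      (λ (px , qx) → index px , Q-resp (≈-elem-index px) qx , ≈-elem-index px)

  module _ {k : ℕ} (S : Size _≈_ (λ _ → ⊤ {ℓ = p}) k) where

    size⇒decidable≈ : Decidable₂ _≈_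
    size⇒decidable≈ x y =
      map′ (index-injective S tt tt) (index-cong S tt tt) (index S tt ≟ᶠ index S tt)

    size-subset : {Q : Pred A q} → Q Respects _≈_ → Decidable Q → ∃[ m ] Size _≈_ Q m
    size-subset Q-resp Q? with size-filter S (λ _ _ → tt) Q-resp Q?
    ... | m , S′ = m , size-cong S′ proj₂ (tt ,_)

    size-image : {B : Set b} {_≈ᴮ_ : Rel B ℓ′} {X : Pred B q} {m : ℕ} → Size _≈ᴮ_ X m →
      (f : B → A) → (∀ {x y} → x ≈ᴮ y → f x ≈ f y) → ∃[ m′ ] Size _≈_ (Image _≈_ f X) m′
    size-image {X = X} X-size f f-cong = size-subset resp image?
      where
      resp : Image _≈_ f X Respects _≈_
      resp y≈z (x , px , fx≈y) = x , px , ≈.trans fx≈y y≈z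
      image? : Decidable (Image _≈_ f X)
      image? y = map′ (λ (i , eq) → elem X-size i , elem-in X-size i , eq) to
        (any? λ i → size⇒decidable≈ (f (elem X-size i)) y)
        where
        to : Image _≈_ f X y → ∃[ i ] (f (elem X-size i) ≈ y)
        to (x , px , fx≈y) with elem-surj X-size x px
        ... | i , x≈ = i , ≈.trans (≈.sym (f-cong x≈)) fx≈y

    size-¬¬decidable : {Q : Pred A q} → Q Respects _≈_ → ¬ ¬ Decidable Q
    size-¬¬decidable {Q = Q} Q-resp ¬Q? = Fin-¬¬decidable k (Q ∘ elem S) λ Q∘elem? →
      ¬Q? λ x → map′ (Q-resp (≈.sym (≈-elem-index S tt))) (Q-resp (≈-elem-index S tt))
                     (Q∘elem? (index S tt))

size-map : {A : Set a} {B : Set b} {_≈ᴬ_ : Rel A ℓ} {_≈ᴮ_ : Rel B ℓ′} → IsEquivalence _≈ᴮ_ →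
  {P : Pred A p} {Q : Pred B q} {k : ℕ} → Size _≈ᴬ_ P k →
  (f : A → B) → (∀ {x y} → x ≈ᴬ y → f x ≈ᴮ f y) → (∀ {x} → P x → Q (f x)) →
  (∀ {x y} → P x → P y → f x ≈ᴮ f y → x ≈ᴬ y) → (∀ {z} → Q z → ∃[ x ] (P x × z ≈ᴮ f x)) →
  Size _≈ᴮ_ Q k
size-map {_≈ᴮ_ = _≈ᴮ_} ≈ᴮ-equiv {Q = Q} S f f-cong P⇒Q f-inj f-surj = record
  { elem = f ∘ elem S
  ; elem-in = P⇒Q ∘ elem-in S
  ; elem-inj = λ i j eq → elem-inj S i j (f-inj (elem-in S i) (elem-in S j) eq)
  ; elem-surj = surj }
  where
  surj : ∀ z → Q z → ∃[ i ] (z ≈ᴮ f (elem S i))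
  surj z qz with f-surj qz
  ... | x , px , z≈fx with elem-surj S x px
  ...   | i , x≈ = i , IsEquivalence.trans ≈ᴮ-equiv z≈fx (f-cong x≈)

size-× : {A : Set a} {B : Set b} {_≈ᴬ_ : Rel A ℓ} {_≈ᴮ_ : Rel B ℓ′} {k m : ℕ} →
  Size _≈ᴬ_ (λ _ → ⊤ {ℓ = p}) k → Size _≈ᴮ_ (λ _ → ⊤ {ℓ = q}) m →
  ∀ {r} → Size (Pointwise _≈ᴬ_ _≈ᴮ_) (λ _ → ⊤ {ℓ = r}) (k * m)
size-× {_≈ᴬ_ = _≈ᴬ_} {_≈ᴮ_} {k} {m} S T = record
  { elem = λ i → let (j , j′) = remQuot {k} m i in elem S j , elem T j′
  ; elem-in = λ _ → tt
  ; elem-inj = λ i i′ (eq , eq′) →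
      remQuot-injective i i′ (≡.cong₂ _,_ (elem-inj S _ _ eq) (elem-inj T _ _ eq′))
  ; elem-surj = surj }
  where
  remQuot-injective : ∀ i i′ → remQuot {k} m i ≡ remQuot {k} m i′ → i ≡ i′
  remQuot-injective i i′ eq = ≡.trans (≡.sym (combine-remQuot {k} m i))
    (≡.trans (cong (λ (j , j′) → combine j j′) eq) (combine-remQuot {k} m i′))
  surj : ∀ z → ⊤ →
    ∃[ i ] (Pointwise _≈ᴬ_ _≈ᴮ_ z (let (j , j′) = remQuot {k} m i in elem S j , elem T j′))
  surj (x , y) _ with elem-surj S x tt | elem-surj T y tt
  ... | j , x≈ | j′ , y≈ = combine j j′ ,
    ≡.subst (λ (i , i′) → Pointwise _≈ᴬ_ _≈ᴮ_ (x , y) (elem S i , elem T i′))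
      (≡.sym (remQuot-combine j j′)) (x≈ , y≈)

record IsSubgroup (G : Group c ℓ) (X : Pred (Group.Carrier G) p) : Set (c ⊔ ℓ ⊔ p) where
  open Group G
  field
    resp : X Respects _≈_
    ε-closed : X ε
    ∙-closed : ∀ {x y} → X x → X y → X (x ∙ y)
    ⁻¹-closed : ∀ {x} → X x → X (x ⁻¹)

  \\-closed : ∀ {x y} → X x → X y → X (x \\ y)
  \\-closed x∈ y∈ = ∙-closed (⁻¹-closed x∈) y∈

full-isSubgroup : (G : Group c ℓ) → IsSubgroup G (λ _ → ⊤ {ℓ = p})
full-isSubgroup G = record
  { resp = λ _ _ → tt ; ε-closed = tt ; ∙-closed = λ _ _ → tt ; ⁻¹-closed = λ _ → tt }

module _ (G : Group c ℓ) where
  open Group G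
  open GroupProperties G
  open import Relation.Binary.Reasoning.Setoid setoid

  \\-∙-\\ : ∀ x y z → (x \\ y) ∙ (y \\ z) ≈ x \\ z
  \\-∙-\\ x y z = begin
    (x \\ y) ∙ (y \\ z)   ≈⟨ assoc _ _ _ ⟩
    x ⁻¹ ∙ (y ∙ (y \\ z)) ≈⟨ ∙-congˡ (\\-leftDividesˡ y z) ⟩
    x \\ z               ∎

  ∙≈∙⇒\\≈// : ∀ {x y z w} → x ∙ y ≈ z ∙ w → z \\ x ≈ w // y
  ∙≈∙⇒\\≈// {x} {y} {z} {w} eq = x≈z//y (z \\ x) y w (begin
    (z \\ x) ∙ y   ≈⟨ assoc _ _ _ ⟩
    z \\ (x ∙ y)   ≈⟨ ∙-congˡ eq ⟩
    z \\ (z ∙ w)   ≈⟨ \\-leftDividesʳ z w ⟩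
    w              ∎)

  module _ {X : Pred Carrier p} {R : Pred Carrier q} {K : Pred Carrier r} {x t s : ℕ}
    (X-size : Size _≈_ X x) (R-size : Size _≈_ R t) (K-size : Size _≈_ K s) where

    transversal-count :
      (∀ {ρ κ} → R ρ → K κ → X (ρ ∙ κ)) →
      (∀ {g} → X g → ∃[ ρ ] (R ρ × K (ρ \\ g))) →
      (∀ {ρ ρ′ κ κ′} → R ρ → R ρ′ → K κ → K κ′ → ρ ∙ κ ≈ ρ′ ∙ κ′ → ρ ≈ ρ′) →
      x ≡ t * s
    transversal-count RK⊆X decompose unique = Fin-×-cantor-schröder-bernstein f-inj g-inj
      where
      e = elem X-size
      ρ : Fin x → Carrier
      ρ i = proj₁ (decompose (elem-in X-size i))
      f : Fin x → Fin t × Fin s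
      f i = let (_ , ρ∈R , κ∈K) = decompose (elem-in X-size i)
            in index isEquivalence R-size ρ∈R , index isEquivalence K-size κ∈K
      f-inj : Injective _≡_ _≡_ f
      f-inj {i} {j} eq = elem-inj X-size i j (begin
        e i                  ≈⟨ \\-leftDividesˡ (ρ i) (e i) ⟨
        ρ i ∙ (ρ i \\ e i)   ≈⟨ ∙-cong (index-injective isEquivalence R-size _ _ (cong proj₁ eq))
                                      (index-injective isEquivalence K-size _ _ (cong proj₂ eq)) ⟩
        ρ j ∙ (ρ j \\ e j)   ≈⟨ \\-leftDividesˡ (ρ j) (e j) ⟩
        e j                  ∎)
      g : Fin t × Fin s → Fin x
      g (j , k) = index isEquivalence X-size (RK⊆X (elem-in R-size j) (elem-in K-size k))
      g-inj : Injective _≡_ _≡_ g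
      g-inj {j , k} {j′ , k′} eq = ≡.cong₂ _,_ j≡j′ (elem-inj K-size k k′ κ≈κ′)
        where
        ρκ≈ρ′κ′ = index-injective isEquivalence X-size _ _ eq
        j≡j′ = elem-inj R-size j j′
          (unique (elem-in R-size j) (elem-in R-size j′) (elem-in K-size k) (elem-in K-size k′)
            ρκ≈ρ′κ′)
        κ≈κ′ = ∙-cancelˡ (elem R-size j) _ _
          (trans ρκ≈ρ′κ′ (∙-congʳ (reflexive (cong (elem R-size) (≡.sym j≡j′)))))

  lagrange : {X : Pred Carrier p} {K : Pred Carrier q} {x s : ℕ} →
    IsSubgroup G X → IsSubgroup G K → (∀ {g} → K g → X g) → Decidable K →
    Size _≈_ X x → Size _≈_ K s → s ∣ x
  lagrange {X = X} {K} {x} {s} X-sub K-sub K⊆X K? X-size K-size =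
    divides t (transversal-count X-size R-size K-size RK⊆X decompose unique)
    where
    module X = IsSubgroup X-sub
    module K = IsSubgroup K-sub
    e = elem X-size
    -- the coset g K is represented by its element of least index
    IsLeast : Pred (Fin x) _
    IsLeast i = ∀ j → K (e j \\ e i) → toℕ i ≤ toℕ j
    leasts = Fin-subset-size x IsLeast (λ i → all? λ j → K? _ →-dec toℕ i ≤? toℕ j)
    t = proj₁ leasts
    R : Pred Carrier _
    R ρ = ∃[ i ] (IsLeast i × ρ ≈ e i)
    R-size : Size _≈_ R t
    R-size = size-restrict isEquivalence X-size (proj₂ leasts)
    RK⊆X : ∀ {ρ κ} → R ρ → K κ → X (ρ ∙ κ)
    RK⊆X (i , _ , ρ≈) κ∈ = X.∙-closed (X.resp (sym ρ≈) (elem-in X-size i)) (K⊆X κ∈)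
    e-index\\∈K : ∀ {g} (g∈ : X g) → K (e (index isEquivalence X-size g∈) \\ g)
    e-index\\∈K g∈ = K.resp (sym (trans (\\-cong₂ (sym (≈-elem-index isEquivalence X-size g∈)) refl)
      (inverseˡ _))) K.ε-closed
    decompose : ∀ {g} → X g → ∃[ ρ ] (R ρ × K (ρ \\ g))
    decompose {g} g∈ with Fin-least x (λ i → K (e i \\ g)) (λ _ → K? _) (_ , e-index\\∈K g∈)
    ... | i , κ∈ , least =
      e i , (i , (λ j κ′∈ → least (K.resp (\\-∙-\\ _ _ _) (K.∙-closed κ′∈ κ∈))) , refl) , κ∈
    unique : ∀ {ρ ρ′ κ κ′} → R ρ → R ρ′ → K κ → K κ′ → ρ ∙ κ ≈ ρ′ ∙ κ′ → ρ ≈ ρ′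
    unique (i , i-least , ρ≈) (i′ , i′-least , ρ′≈) κ∈ κ′∈ eq =
      trans ρ≈ (trans (reflexive (cong e (toℕ-injective (≤-antisym i≤i′ i′≤i)))) (sym ρ′≈))
      where
      i≤i′ = i-least i′ (K.resp (trans (sym (∙≈∙⇒\\≈// eq)) (\\-cong₂ ρ′≈ ρ≈))
        (K.∙-closed κ′∈ (K.⁻¹-closed κ∈)))
      i′≤i = i′-least i (K.resp (trans (sym (∙≈∙⇒\\≈// (sym eq))) (\\-cong₂ ρ≈ ρ′≈))
        (K.∙-closed κ∈ (K.⁻¹-closed κ′∈)))

module _ (G : Group c₁ ℓ₁) (H : Group c₂ ℓ₂) {π : Group.Carrier G → Group.Carrier H}
  (π-hom : GroupMorphisms.IsGroupHomomorphism (Group.rawGroup G) (Group.rawGroup H) π) where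
  private
    module G = Group G
    module H = Group H
    module π = GroupMorphisms.IsGroupHomomorphism π-hom
  open import Relation.Binary.Reasoning.Setoid H.setoid

  π-\\ : ∀ x y → π (x G.\\ y) H.≈ π x H.\\ π y
  π-\\ x y = H.trans (π.homo _ _) (H.∙-congʳ (π.⁻¹-homo x))

  π-∙-kernel : ∀ {x κ} → π κ H.≈ H.ε → π (x G.∙ κ) H.≈ π x
  π-∙-kernel {x} {κ} πκ≈ε = begin
    π (x G.∙ κ)    ≈⟨ π.homo x κ ⟩
    π x H.∙ π κ    ≈⟨ H.∙-congˡ πκ≈ε ⟩
    π x H.∙ H.ε    ≈⟨ H.identityʳ _ ⟩
    π x            ∎

  kernel-resp : (λ g → π g H.≈ H.ε) Respects G._≈_
  kernel-resp x≈y πx≈ε = H.trans (H.sym (π.⟦⟧-cong x≈y)) πx≈ε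

  image-isSubgroup : {X : Pred G.Carrier p} → IsSubgroup G X → IsSubgroup H (Image H._≈_ π X)
  image-isSubgroup X-sub = record
    { resp = λ y≈z (x , x∈ , πx≈y) → x , x∈ , H.trans πx≈y y≈z
    ; ε-closed = G.ε , X.ε-closed , π.ε-homo
    ; ∙-closed = λ (x , x∈ , πx≈) (y , y∈ , πy≈) →
        x G.∙ y , X.∙-closed x∈ y∈ , H.trans (π.homo x y) (H.∙-cong πx≈ πy≈)
    ; ⁻¹-closed = λ (x , x∈ , πx≈) →
        x G.⁻¹ , X.⁻¹-closed x∈ , H.trans (π.⁻¹-homo x) (H.⁻¹-cong πx≈) }
    where module X = IsSubgroup X-sub

  module _ {X : Pred G.Carrier p} (X-sub : IsSubgroup G X) {x y : ℕ}
    (X-size : Size G._≈_ X x) (Y-size : Size H._≈_ (Image H._≈_ π X) y) where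
    private module X = IsSubgroup X-sub

    kernel-count : {s : ℕ} → Size G._≈_ (λ g → X g × π g H.≈ H.ε) s → x ≡ y * s
    kernel-count K-size = transversal-count G X-size R-size K-size RK⊆X decompose unique
      where
      pre : Fin y → G.Carrier
      pre j = proj₁ (elem-in Y-size j)
      pre∈X : ∀ j → X (pre j)
      pre∈X j = proj₁ (proj₂ (elem-in Y-size j))
      π-pre : ∀ j → π (pre j) H.≈ elem Y-size j
      π-pre j = proj₂ (proj₂ (elem-in Y-size j))
      pre-injective : ∀ {j j′} → π (pre j) H.≈ π (pre j′) → j ≡ j′
      pre-injective {j} {j′} eq =
        elem-inj Y-size j j′ (H.trans (H.sym (π-pre j)) (H.trans eq (π-pre j′)))
      R : Pred G.Carrier _
      R ρ = ∃[ j ] (ρ G.≈ pre j)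
      R-size : Size G._≈_ R y
      R-size = record
        { elem = pre ; elem-in = λ j → j , G.refl
        ; elem-inj = λ _ _ → pre-injective ∘ π.⟦⟧-cong ; elem-surj = λ _ ρ∈ → ρ∈ }
      RK⊆X : ∀ {ρ κ} → R ρ → X κ × π κ H.≈ H.ε → X (ρ G.∙ κ)
      RK⊆X (j , ρ≈) (κ∈ , _) = X.∙-closed (X.resp (G.sym ρ≈) (pre∈X j)) κ∈
      decompose : ∀ {g} → X g → ∃[ ρ ] (R ρ × X (ρ G.\\ g) × π (ρ G.\\ g) H.≈ H.ε)
      decompose {g} g∈ = pre j , (j , G.refl) , X.\\-closed (pre∈X j) g∈ , (begin
        π (pre j G.\\ g)     ≈⟨ π-\\ (pre j) g ⟩
        π (pre j) H.\\ π g   ≈⟨ H.∙-congʳ (H.⁻¹-cong π-pre-j≈π-g) ⟩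
        π g H.\\ π g         ≈⟨ H.inverseˡ (π g) ⟩
        H.ε                  ∎)
        where
        πg∈Y = g , g∈ , H.refl
        j = index H.isEquivalence Y-size πg∈Y
        π-pre-j≈π-g = H.trans (π-pre j) (H.sym (≈-elem-index H.isEquivalence Y-size πg∈Y))
      unique : ∀ {ρ ρ′ κ κ′} → R ρ → R ρ′ → X κ × π κ H.≈ H.ε → X κ′ × π κ′ H.≈ H.ε →
        ρ G.∙ κ G.≈ ρ′ G.∙ κ′ → ρ G.≈ ρ′
      unique {ρ} {ρ′} {κ} {κ′} (j , ρ≈) (j′ , ρ′≈) (_ , πκ≈ε) (_ , πκ′≈ε) eq =
        G.trans ρ≈ (G.trans (G.reflexive (cong pre (pre-injective (begin
          π (pre j)      ≈⟨ π.⟦⟧-cong ρ≈ ⟨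
          π ρ            ≈⟨ π-∙-kernel πκ≈ε ⟨
          π (ρ G.∙ κ)    ≈⟨ π.⟦⟧-cong eq ⟩
          π (ρ′ G.∙ κ′)  ≈⟨ π-∙-kernel πκ′≈ε ⟩
          π ρ′           ≈⟨ π.⟦⟧-cong ρ′≈ ⟩
          π (pre j′)     ∎)))) (G.sym ρ′≈))

    image-size-∣ : Decidable₂ H._≈_ → y ∣ x
    image-size-∣ _≈?_ with size-filter G.isEquivalence X-size X.resp kernel-resp (λ g → π g ≈? H.ε)
    ... | s , K-size = divides s (≡.trans (kernel-count K-size) (*-comm y s))

record IsWordHom {r : ℕ} (G : Group c ℓ) (φ : Word r → Group.Carrier G) : Set (c ⊔ ℓ) where
  open Group G
  field
    []-homo : φ [] ≈ ε
    ++-homo : ∀ w v → φ (w ++ v) ≈ φ w ∙ φ v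
    invW-homo : ∀ w → φ (invW w) ≈ φ w ⁻¹

invW-∷ : ∀ {r} l (w : Word r) → invW (l ∷ w) ≡ invW w ++ invW [ l ]
invW-∷ (i , b) w = unfold-reverse (i , not b) (map (λ { (i , b) → (i , not b) }) w)

bar-++ : ∀ {r} (w v : Word r) → bar (w ++ v) ≡ bar w ++ bar v
bar-++ [] v = ≡.refl
bar-++ ((i , false) ∷ w) v =
  ≡.trans (cong (barGen i ++_) (bar-++ w v)) (≡.sym (++-assoc (barGen i) _ _))
bar-++ ((i , true) ∷ w) v =
  ≡.trans (cong (invW (barGen i) ++_) (bar-++ w v)) (≡.sym (++-assoc (invW (barGen i)) _ _))

module _ {r : ℕ} (G : Group c ℓ) where
  open Group G
  open GroupProperties G using (⁻¹-anti-homo-∙; ⁻¹-involutive; ε⁻¹≈ε)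
  open import Relation.Binary.Reasoning.Setoid setoid

  isWordHom-byLetters : {φ : Word r → Carrier} → φ [] ≈ ε → (∀ w v → φ (w ++ v) ≈ φ w ∙ φ v) →
    (∀ l → φ (invW [ l ]) ≈ φ [ l ] ⁻¹) → IsWordHom G φ
  isWordHom-byLetters {φ} []-homo ++-homo letter-homo = record
    { []-homo = []-homo ; ++-homo = ++-homo ; invW-homo = invW-homo }
    where
    invW-homo : ∀ w → φ (invW w) ≈ φ w ⁻¹
    invW-homo [] = trans []-homo (sym (trans (⁻¹-cong []-homo) ε⁻¹≈ε))
    invW-homo (l ∷ w) = begin
      φ (invW (l ∷ w))               ≡⟨ cong φ (invW-∷ l w) ⟩
      φ (invW w ++ invW [ l ])       ≈⟨ ++-homo (invW w) _ ⟩
      φ (invW w) ∙ φ (invW [ l ])    ≈⟨ ∙-cong (invW-homo w) (letter-homo l) ⟩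
      φ w ⁻¹ ∙ φ [ l ] ⁻¹            ≈⟨ ⁻¹-anti-homo-∙ _ _ ⟨
      (φ [ l ] ∙ φ w) ⁻¹             ≈⟨ ⁻¹-cong (++-homo [ l ] w) ⟨
      φ (l ∷ w) ⁻¹                   ∎

  eval-isWordHom : (σ : Fin r → Carrier) → IsWordHom G (eval G σ)
  eval-isWordHom σ = isWordHom-byLetters refl ++-homo letter-homo
    where
    ++-homo : ∀ w v → eval G σ (w ++ v) ≈ eval G σ w ∙ eval G σ v
    ++-homo [] v = sym (identityˡ _)
    ++-homo ((i , false) ∷ w) v = trans (∙-congˡ (++-homo w v)) (sym (assoc _ _ _))
    ++-homo ((i , true) ∷ w) v = trans (∙-congˡ (++-homo w v)) (sym (assoc _ _ _))
    letter-homo : ∀ l → eval G σ (invW [ l ]) ≈ eval G σ [ l ] ⁻¹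
    letter-homo (i , false) = trans (identityʳ _) (⁻¹-cong (sym (identityʳ _)))
    letter-homo (i , true) =
      trans (identityʳ _) (trans (sym (⁻¹-involutive _)) (⁻¹-cong (sym (identityʳ _))))

  ∘bar-isWordHom : {φ : Word r → Carrier} → IsWordHom G φ → IsWordHom G (φ ∘ bar)
  ∘bar-isWordHom {φ} φ-hom = isWordHom-byLetters φ.[]-homo
    (λ w v → trans (reflexive (cong φ (bar-++ w v))) (φ.++-homo (bar w) (bar v))) letter-homo
    where
    module φ = IsWordHom φ-hom
    letter-homo : ∀ l → φ (bar (invW [ l ])) ≈ φ (bar [ l ]) ⁻¹
    letter-homo (i , false) rewrite ++-identityʳ (invW (barGen i)) | ++-identityʳ (barGen i) =
      φ.invW-homo (barGen i)
    letter-homo (i , true) rewrite ++-identityʳ (invW (barGen i)) | ++-identityʳ (barGen i) =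
      trans (sym (⁻¹-involutive _)) (⁻¹-cong (sym (φ.invW-homo (barGen i))))

module _ (G : Group c₁ ℓ₁) (H : Group c₂ ℓ₂) where
  private
    module G = Group G
    module H = Group H

  ⟨,⟩-isWordHom : ∀ {r} {φ : Word r → G.Carrier} {ψ : Word r → H.Carrier} →
    IsWordHom G φ → IsWordHom H ψ → IsWordHom (DirectProduct.group G H) (λ w → φ w , ψ w)
  ⟨,⟩-isWordHom φ-hom ψ-hom = record
    { []-homo = φ.[]-homo , ψ.[]-homo
    ; ++-homo = λ w v → φ.++-homo w v , ψ.++-homo w v
    ; invW-homo = λ w → φ.invW-homo w , ψ.invW-homo w }
    where
    module φ = IsWordHom φ-hom
    module ψ = IsWordHom ψ-hom

  open GroupMorphisms

  proj₁-isGroupHomomorphism :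
    IsGroupHomomorphism (Group.rawGroup (DirectProduct.group G H)) G.rawGroup proj₁
  proj₁-isGroupHomomorphism = record
    { isMonoidHomomorphism =
        DirectProductMorphisms.Monoid.Proj₁.isMonoidHomomorphism G.rawMonoid H.rawMonoid G.refl
    ; ⁻¹-homo = λ _ → G.refl }

  proj₂-isGroupHomomorphism :
    IsGroupHomomorphism (Group.rawGroup (DirectProduct.group G H)) H.rawGroup proj₂
  proj₂-isGroupHomomorphism = record
    { isMonoidHomomorphism =
        DirectProductMorphisms.Monoid.Proj₂.isMonoidHomomorphism G.rawMonoid H.rawMonoid H.refl
    ; ⁻¹-homo = λ _ → H.refl }

  ImageOfKernel : ∀ {r} → (Word r → H.Carrier) → (Word r → G.Carrier) → Pred G.Carrier (ℓ₁ ⊔ ℓ₂)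
  ImageOfKernel ψ φ g = ∃[ w ] (ψ w H.≈ H.ε × φ w G.≈ g)

  imageOfKernel-isSubgroup : ∀ {r} {ψ : Word r → H.Carrier} {φ : Word r → G.Carrier} →
    IsWordHom H ψ → IsWordHom G φ → IsSubgroup G (ImageOfKernel ψ φ)
  imageOfKernel-isSubgroup ψ-hom φ-hom = record
    { resp = λ g≈h (w , ψw≈ε , φw≈g) → w , ψw≈ε , G.trans φw≈g g≈h
    ; ε-closed = [] , ψ.[]-homo , φ.[]-homo
    ; ∙-closed = λ (w , ψw≈ε , φw≈g) (v , ψv≈ε , φv≈h) → w ++ v
        , H.trans (ψ.++-homo w v) (H.trans (H.∙-cong ψw≈ε ψv≈ε) (H.identityˡ H.ε))
        , G.trans (φ.++-homo w v) (G.∙-cong φw≈g φv≈h)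
    ; ⁻¹-closed = λ (w , ψw≈ε , φw≈g) → invW w
        , H.trans (ψ.invW-homo w) (H.trans (H.⁻¹-cong ψw≈ε) (GroupProperties.ε⁻¹≈ε H))
        , G.trans (φ.invW-homo w) (G.⁻¹-cong φw≈g) }
    where
    module φ = IsWordHom φ-hom
    module ψ = IsWordHom ψ-hom

gcd-quotient-∣-cofactor : ∀ {x g y d q} .{{_ : NonZero d}} →
  x ≡ d * y → d ∣ g → q * gcd x g ≡ x → q ∣ y
gcd-quotient-∣-cofactor {x} {g} {y} {d} {q} x≡dy d∣g q*gcd≡x =
  *-cancelˡ-∣ d (≡.subst₂ _∣_ (*-comm q d) (≡.trans q*gcd≡x x≡dy) (*-monoʳ-∣ q d∣gcd))
  where
  d∣gcd : d ∣ gcd x g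
  d∣gcd = gcd-greatest (divides y (≡.trans x≡dy (*-comm d y))) d∣g

gcd-quotient-∣-cofactor′ : ∀ {x l t y g q} {{_ : NonZero t}} →
  x * l ≡ t * y → l ∣ t → t ∣ g → q * gcd x g ≡ x → q ∣ y
gcd-quotient-∣-cofactor′ {x} {l} {t} {y} {{t≢0}} x*l≡t*y (divides d t≡d*l) t∣g =
  gcd-quotient-∣-cofactor {{d≢0}} x≡d*y (∣-trans (divides l (≡.trans t≡d*l (*-comm d l))) t∣g)
  where
  d*l≢0 : NonZero (d * l)
  d*l≢0 = ≡.subst NonZero t≡d*l t≢0
  d≢0 = m*n≢0⇒m≢0 d {{d*l≢0}}
  instance
    l≢0 : NonZero l
    l≢0 = m*n≢0⇒n≢0 d {{d*l≢0}}
  x≡d*y : x ≡ d * y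
  x≡d*y = *-cancelʳ-≡ x (d * y) l
    (≡.trans x*l≡t*y (≡.trans (cong (_* y) t≡d*l) (xy∙z≈xz∙y d l y)))

module _ {n : ℕ} (P : RotGroup n c₁ ℓ₁) (Q : RotGroup n c₂ ℓ₂) where
  private
    module P = RotGroup P
    module Q = RotGroup Q
    G = DirectProduct.group P.group Q.group
    module G = Group G
    evP = eval P.group P.σ
    evQ = eval Q.group Q.σ
    evP-hom = eval-isWordHom P.group P.σ
    evQ-hom = eval-isWordHom Q.group Q.σ

  Twisted : Pred G.Carrier (ℓ₁ ⊔ ℓ₂)
  Twisted = ImageOfKernel G P.group evP (λ w → evP (bar w) , evQ w)

  twisted-isSubgroup : IsSubgroup G Twisted
  twisted-isSubgroup = imageOfKernel-isSubgroup G P.group evP-hom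
    (⟨,⟩-isWordHom P.group Q.group (∘bar-isWordHom P.group evP-hom) evQ-hom)

  mix-isSubgroup : IsSubgroup G (XMixMem P Q)
  mix-isSubgroup = imageOfKernel-isSubgroup G G
    (⟨,⟩-isWordHom P.group Q.group evP-hom evQ-hom)
    (⟨,⟩-isWordHom P.group Q.group (∘bar-isWordHom P.group evP-hom) (∘bar-isWordHom Q.group evQ-hom))

  TwistedOverε : Pred Q.Carrier (ℓ₁ ⊔ ℓ₂)
  TwistedOverε h = Twisted (P.ε , h)

  twistedOverε-isSubgroup : IsSubgroup Q.group TwistedOverε
  twistedOverε-isSubgroup = record
    { resp = λ h≈h′ → T.resp (P.refl , h≈h′)
    ; ε-closed = T.ε-closed
    ; ∙-closed = λ h∈ h′∈ → T.resp (P.identityˡ P.ε , Q.refl) (T.∙-closed h∈ h′∈)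
    ; ⁻¹-closed = λ h∈ → T.resp (GroupProperties.ε⁻¹≈ε P.group , Q.refl) (T.⁻¹-closed h∈) }
    where module T = IsSubgroup twisted-isSubgroup

  image₁-twisted-size : ∀ {x} → OrderX P x → Size P._≈_ (Image P._≈_ proj₁ Twisted) x
  image₁-twisted-size XP-size = size-cong XP-size
    (λ (w , w∈M , w̄≈g) → (evP (bar w) , evQ w) , (w , w∈M , P.refl , Q.refl) , w̄≈g)
    (λ (_ , (w , w∈M , w̄≈g′ , _) , g′≈g) → w , w∈M , P.trans w̄≈g′ g′≈g)

  kernel₁-twisted-size : ∀ {l} → Size Q._≈_ TwistedOverε l →
    Size G._≈_ (λ a → Twisted a × proj₁ a P.≈ P.ε) l
  kernel₁-twisted-size L-size = size-map G.isEquivalence L-size (P.ε ,_) (P.refl ,_)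
    (_, P.refl) (λ _ _ → proj₂)
    (λ { {g , h} (a∈ , g≈ε) → h , T.resp (g≈ε , Q.refl) a∈ , g≈ε , Q.refl })
    where module T = IsSubgroup twisted-isSubgroup

  -- (g, ε) ∈ Twisted means g = w̄ M with w ∈ M ∩ K: this is where the mix enters.
  kernel₂-twisted-size : ∀ {y} → Size P._≈_ (Image P._≈_ proj₁ (XMixMem P Q)) y →
    Size G._≈_ (λ a → Twisted a × proj₂ a Q.≈ Q.ε) y
  kernel₂-twisted-size Y-size = size-map G.isEquivalence Y-size (_, Q.ε) (_, Q.refl)
    (λ (_ , (w , (w∈M , w∈K) , w̄≈g′ , _) , g′≈g) →
      (w , w∈M , P.trans w̄≈g′ g′≈g , w∈K) , Q.refl)
    (λ _ _ → proj₁)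
    (λ { {g , h} ((w , w∈M , w̄≈g , w≈h) , h≈ε) →
         g , ((evP (bar w) , evQ (bar w)) , (w , (w∈M , Q.trans w≈h h≈ε) , P.refl , Q.refl) , w̄≈g)
           , P.refl , h≈ε })

  module _ {gP gQ xP xPQ : ℕ} (P-size : OrderΓ P gP) (Q-size : OrderΓ Q gQ)
    (XP-size : OrderX P xP) (mix-size : OrderXMix P Q xPQ) where
    private
      module T = IsSubgroup twisted-isSubgroup
      G-size : Size G._≈_ (λ _ → ⊤ {ℓ = ℓ₁ ⊔ ℓ₂}) (gP * gQ)
      G-size = size-× P-size Q-size
      proj₁-hom = proj₁-isGroupHomomorphism P.group Q.group
      proj₂-hom = proj₂-isGroupHomomorphism P.group Q.group
      image₂-isSubgroup = image-isSubgroup G Q.group proj₂-hom twisted-isSubgroup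

    gcd-quotient-∣-image₁-mix : Decidable Twisted →
      ∀ {y} → Size P._≈_ (Image P._≈_ proj₁ (XMixMem P Q)) y → ∀ q → q * gcd xP gQ ≡ xP → q ∣ y
    gcd-quotient-∣-image₁-mix Twisted? Y-size q =
      gcd-quotient-∣-cofactor′ {{size-nonZero T-size (IsSubgroup.ε-closed image₂-isSubgroup)}}
        (≡.trans (≡.sym s≡xP*l) s≡t*y) l∣t t∣gQ
      where
      S-size = proj₂ (size-subset G.isEquivalence G-size T.resp Twisted?)
      T-size = proj₂ (size-image Q.isEquivalence Q-size S-size proj₂ proj₂)
      L? : Decidable TwistedOverε
      L? h = Twisted? (P.ε , h)
      L-size = proj₂ (size-subset Q.isEquivalence Q-size (IsSubgroup.resp twistedOverε-isSubgroup) L?)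
      T? = size⇒decidable Q.isEquivalence T-size (size⇒decidable≈ Q.isEquivalence Q-size)
        (IsSubgroup.resp image₂-isSubgroup)
      s≡xP*l = kernel-count G P.group proj₁-hom twisted-isSubgroup S-size
        (image₁-twisted-size XP-size) (kernel₁-twisted-size L-size)
      s≡t*y = kernel-count G Q.group proj₂-hom twisted-isSubgroup S-size T-size
        (kernel₂-twisted-size Y-size)
      l∣t = lagrange Q.group image₂-isSubgroup twistedOverε-isSubgroup
        (λ h∈ → (P.ε , _) , h∈ , Q.refl) L? T-size L-size
      t∣gQ = lagrange Q.group (full-isSubgroup Q.group) image₂-isSubgroup (λ _ → tt) T? Q-size T-size

    gcd-quotient-∣-mix : ∀ q → q * gcd xP gQ ≡ xP → q ∣ xPQ
    -- Membership in Twisted is only ¬¬-decidable, which suffices for the decidable goal.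
    gcd-quotient-∣-mix q q*gcd≡xP = decidable-stable (q ∣? xPQ) λ q∤xPQ →
      size-¬¬decidable G.isEquivalence G-size T.resp λ Twisted? →
        q∤xPQ (∣-trans (gcd-quotient-∣-image₁-mix Twisted? Y-size q q*gcd≡xP)
          (image-size-∣ G P.group proj₁-hom mix-isSubgroup mix-size Y-size
            (size⇒decidable≈ P.isEquivalence P-size)))
      where
      Y-size = proj₂ (size-image P.isEquivalence P-size mix-size proj₁ proj₁)

xMixMem-swap : ∀ {n} (P : RotGroup n c₁ ℓ₁) (Q : RotGroup n c₂ ℓ₂) {a} →
  XMixMem P Q a → XMixMem Q P (swap a)
xMixMem-swap P Q (w , (w∈M , w∈K) , w̄≈g , w̄≈h) = w , (w∈K , w∈M) , w̄≈h , w̄≈g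

mix-size-swap : ∀ {n} (P : RotGroup n c₁ ℓ₁) (Q : RotGroup n c₂ ℓ₂) {k : ℕ} →
  OrderXMix P Q k → OrderXMix Q P k
mix-size-swap P Q mix-size = size-map (Group.isEquivalence (DirectProduct.group (group Q) (group P)))
  mix-size swap swap (xMixMem-swap P Q) (λ _ _ → swap)
  (λ a∈ → _ , xMixMem-swap Q P a∈ , refl Q , refl P)
  where open RotGroup using (group; refl)

theorem4p4 : ∀ {c₁ ℓ₁ c₂ ℓ₂} (n : ℕ) → 3 ≤ n →
    (P : RotGroup n c₁ ℓ₁) (Q : RotGroup n c₂ ℓ₂) →
    (gP gQ xP xQ xPQ : ℕ) →
    OrderΓ P gP → OrderΓ Q gQ →
    OrderX P xP → OrderX Q xQ → OrderXMix P Q xPQ →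
    (∀ q → q * gcd xP gQ ≡ xP → q ∣ xPQ)
    × (∀ q → q * gcd xQ gP ≡ xQ → q ∣ xPQ)
theorem4p4 n _ P Q gP gQ xP xQ xPQ P-size Q-size XP-size XQ-size mix-size =
    gcd-quotient-∣-mix P Q P-size Q-size XP-size mix-size
  , gcd-quotient-∣-mix Q P Q-size P-size XQ-size (mix-size-swap P Q mix-size)
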